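{- Let $M=(m_1,\ldots,m_n)$ be a finite Meeussen sequence, and call an element $u\in ur(M)$ with $u\geq m_n$ a candidate. Suppose there are exactly $k$ candidates, $u_1<u_2<\cdots<u_k$. Then for each $j$ with $1\leq j\leq k$, the extended sequence $(m_1,\ldots,m_n,u_j+1)$ is also a finite Meeussen sequence, and it has exactly $k+j$ candidates (i.e. exactly $k+j$ elements $v\in ur((m_1,\ldots,m_n,u_j+1))$ with $v\geq u_j+1$).
   Context: For a finite or infinite integer sequence $A=(a_1,a_2,\ldots)$, $r(A)$ denotes the set of integers representable as $a_{i_1}+\cdots+a_{i_s}$ for some indices $i_1<\cdots<i_s$ (the empty sum $0$ included), and $ur(A)$ denotes the set of integers representable in this way in exactly one way (i.e. by exactly one set of indices). An infinite Meeussen sequence is an infinite sequence of positive integers $(m_1,m_2,\ldots)$ with $m_1=1$, $m_i<m_{i+1}$ for all $i$, such that every nonnegative integer lies in $r(M)$ and $m_i-1\in ur(M)$ for every $i$. A finite Meeussen sequence is an initial segment $(m_1,\ldots,m_n)$ of an infinite Meeussen sequence. -}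

module Defs where

open import Data.Nat using (ℕ; zero; suc; _+_; _∸_; _≤_; _<_; _≤ᵇ_)
open import Data.Bool using (if_then_else_)
open import Data.List using (List; []; _∷_; map; upTo; length; lookup; _++_; [_])
open import Data.Fin using (Fin; toℕ)
open import Data.Product using (Σ; ∃; _×_)
open import Function.Bundles using (_⇔_)
open import Relation.Binary.PropositionalEquality using (_≡_)

-- Number of index sets {i₁ < ⋯ < i_s} of positions of the finite sequence
-- A with a_{i₁} + ⋯ + a_{i_s} = x  (empty index set gives 0).
-- Each index set either omits or contains the first position.
nrep : List ℕ → ℕ → ℕ
nrep []       zero    = 1
nrep []       (suc _) = 0
nrep (a ∷ as) x = nrep as x + (if a ≤ᵇ x then nrep as (x ∸ a) else 0)

_∈r_ : ℕ → List ℕ → Set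
x ∈r A = 1 ≤ nrep A x

_∈ur_ : ℕ → List ℕ → Set
x ∈ur A = nrep A x ≡ 1

-- Infinite sequences (0-indexed: m i is the paper's m_{i+1}).
-- prefix m N = (m_1, …, m_N)
prefix : (ℕ → ℕ) → ℕ → List ℕ
prefix m N = map m (upTo N)

-- Every finite index set lies inside some prefix, and the number of
-- representations using indices < N is monotone in N.
-- x ∈ r(M): some finite index set sums to x.
_∈rInf_ : ℕ → (ℕ → ℕ) → Set
x ∈rInf m = ∃ λ N → x ∈r prefix m N

_∈urInf_ : ℕ → (ℕ → ℕ) → Set
x ∈urInf m = (∃ λ N → nrep (prefix m N) x ≡ 1) × (∀ N → nrep (prefix m N) x ≤ 1)

record InfMeeussen (m : ℕ → ℕ) : Set where
  field
    first    : m 0 ≡ 1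
    incr     : ∀ i → m i < m (suc i)
    complete : ∀ x → x ∈rInf m
    unique   : ∀ i → (m i ∸ 1) ∈urInf m

FinMeeussen : List ℕ → Set
FinMeeussen M = Σ (ℕ → ℕ) λ m → InfMeeussen m × (∀ (i : Fin (length M)) → lookup M i ≡ m (toℕ i))

IsCandidate : List ℕ → ℕ → ℕ → Set
IsCandidate ms last u = (u ∈ur (ms ++ [ last ])) × (last ≤ u)

CandidatesEnum : List ℕ → ℕ → (k : ℕ) → (Fin k → ℕ) → Set
CandidatesEnum ms last k u =
  (∀ (i j : Fin k) → toℕ i < toℕ j → u i < u j) ×
  (∀ v → IsCandidate ms last v ⇔ (∃ λ i → u i ≡ v))

HasExactlyCandidates : List ℕ → ℕ → ℕ → Set
HasExactlyCandidates ms last k = Σ (Fin k → ℕ) λ u → CandidatesEnum ms last k u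

{-# OPTIONS --safe #-}
-- A list is a finite Meeussen sequence iff it is built term by term, each new term b being
-- positive, larger than the previous terms, and such that b ∸ 1 is uniquely represented by them.
-- Such a list L extends to an infinite Meeussen sequence by appending suc (sum L) and doubling
-- from then on, because sum L is always uniquely represented (by all of L).
-- These lists are complete: every x ≤ sum L is representable.  Hence for M = ms ++ [ mn ] with
-- S = sum M, a value v ≥ a is uniquely representable by M ++ [ a ] iff v > S and v ∸ a ∈ ur(M);
-- moreover x ↦ S ∸ x preserves ur(M) and sends every x ∈ ur(M) with x < mn to a candidate.
-- For a = u_j + 1 the candidates of M ++ [ a ] are therefore the k values u_i + a together with
-- the j + 1 values S ∸ u_i + a for i ≤ j, all of the latter lying below all of the former.

module Submission where

open import Defs
open import Data.Nat using (ℕ; zero; suc; _+_; _*_; _∸_; _^_; _≤_; _<_; _≤ᵇ_; _≤?_; z≤n; s≤s; s≤s⁻¹; z<s)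
open import Data.Nat.Properties
open import Data.Nat.ListAction using (sum)
open import Data.Nat.ListAction.Properties using (sum-++)
open import Data.Bool using (true; false; if_then_else_)
open import Data.List using (List; []; _∷_; _++_; [_]; length; lookup; applyUpTo; upTo)
open import Data.List.Properties using (map-upTo; applyUpTo-∷ʳ; ∷ʳ-injective; ++-identityʳ; ++-assoc; length-map; length-upTo)
open import Data.List.Relation.Unary.All as All using (All; []; _∷_)
open import Data.List.Relation.Unary.All.Properties using (++⁺; ++⁻ʳ; applyUpTo⁺₁)
import Data.Fin as Fin
open import Data.Fin using (Fin; toℕ; fromℕ<; inject≤; opposite; splitAt; join; _↑ˡ_; _↑ʳ_)
open import Data.Fin.Properties using (toℕ<n; toℕ-injective; toℕ-fromℕ<; toℕ-inject≤; opposite-prop; opposite-involutive; toℕ-↑ˡ; toℕ-↑ʳ; join-splitAt)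
open import Data.Vec.Functional as Vector using ()
open import Data.Vec.Functional.Properties using (lookup-++ˡ; lookup-++ʳ)
open import Data.Product using (∃; _×_; _,_; proj₁; proj₂)
open import Data.Sum using (inj₁; inj₂; [_,_]′)
open import Function using (_∘_)
open import Function.Bundles using (_⇔_; mk⇔; Equivalence)
open import Function.Construct.Composition using (_⇔-∘_)
open import Level using (0ℓ)
open import Relation.Nullary using (yes; no; contradiction)
open import Relation.Nullary.Reflects using (ofʸ; ofⁿ)
open import Relation.Unary using (Pred; _∪_; _∩_)
open import Relation.Binary.PropositionalEquality using (_≡_; refl; sym; trans; cong; cong₂; subst; subst₂; module ≡-Reasoning)
open import Algebra.Properties.CommutativeSemigroup +-commutativeSemigroup using (interchange)

-- nrep (a ∷ L) x ≡ nrep L x + shift a (nrep L) x holds by definition.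
shift : ℕ → (ℕ → ℕ) → ℕ → ℕ
shift a f x = if a ≤ᵇ x then f (x ∸ a) else 0

module _ (f : ℕ → ℕ) {a : ℕ} where

  shift-≤ : ∀ {x} → a ≤ x → shift a f x ≡ f (x ∸ a)
  shift-≤ {x} a≤x with a ≤ᵇ x | ≤ᵇ-reflects-≤ a x
  ... | true  | _        = refl
  ... | false | ofⁿ a≰x = contradiction a≤x a≰x

  shift-> : ∀ {x} → x < a → shift a f x ≡ 0
  shift-> {x} x<a with a ≤ᵇ x | ≤ᵇ-reflects-≤ a x
  ... | true  | ofʸ a≤x = contradiction a≤x (<⇒≱ x<a)
  ... | false | _        = refl

shift-cong : ∀ a {f g} → (∀ y → f y ≡ g y) → ∀ x → shift a f x ≡ shift a g x
shift-cong a f≗g x with a ≤ᵇ x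
... | true  = f≗g (x ∸ a)
... | false = refl

shift-distrib-+ : ∀ a f g x → shift a (λ y → f y + g y) x ≡ shift a f x + shift a g x
shift-distrib-+ a f g x with a ≤ᵇ x
... | true  = refl
... | false = refl

shift-shift : ∀ a b f x → shift a (shift b f) x ≡ shift (a + b) f x
shift-shift a b f x with a ≤? x
... | no a≰x = trans (shift-> (shift b f) x<a) (sym (shift-> f (<-≤-trans x<a (m≤m+n a b))))
  where
    x<a : x < a
    x<a = ≰⇒> a≰x
... | yes a≤x with b ≤? x ∸ a
...   | yes b≤x∸a = begin
  shift a (shift b f) x ≡⟨ shift-≤ (shift b f) a≤x ⟩
  shift b f (x ∸ a)      ≡⟨ shift-≤ f b≤x∸a ⟩
  f (x ∸ a ∸ b)          ≡⟨ cong f (∸-+-assoc x a b) ⟩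
  f (x ∸ (a + b))        ≡⟨ shift-≤ f a+b≤x ⟨
  shift (a + b) f x      ∎
  where
    open ≡-Reasoning
    a+b≤x : a + b ≤ x
    a+b≤x = subst (_≤ x) (+-comm b a) (m≤o∸n⇒m+n≤o b a≤x b≤x∸a)
...   | no b≰x∸a = begin
  shift a (shift b f) x ≡⟨ shift-≤ (shift b f) a≤x ⟩
  shift b f (x ∸ a)      ≡⟨ shift-> f (≰⇒> b≰x∸a) ⟩
  0                      ≡⟨ shift-> f x<a+b ⟨
  shift (a + b) f x      ∎
  where
    open ≡-Reasoning
    x<a+b : x < a + b
    x<a+b = ≰⇒> λ a+b≤x → b≰x∸a (m+n≤o⇒m≤o∸n b (subst (_≤ x) (+-comm a b) a+b≤x))

shift-comm : ∀ a b f x → shift a (shift b f) x ≡ shift b (shift a f) x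
shift-comm a b f x = begin
  shift a (shift b f) x ≡⟨ shift-shift a b f x ⟩
  shift (a + b) f x      ≡⟨ cong (λ c → shift c f x) (+-comm a b) ⟩
  shift (b + a) f x      ≡⟨ shift-shift b a f x ⟨
  shift b (shift a f) x  ∎
  where open ≡-Reasoning

nrep-∷ʳ : ∀ L b x → nrep (L ++ [ b ]) x ≡ nrep L x + shift b (nrep L) x
nrep-∷ʳ []      b x = refl
nrep-∷ʳ (c ∷ L) b x = begin
  nrep (L ++ [ b ]) x + shift c (nrep (L ++ [ b ])) x
    ≡⟨ cong₂ _+_ (nrep-∷ʳ L b x) (shift-cong c (nrep-∷ʳ L b) x) ⟩
  (N x + shift b N x) + shift c (λ y → N y + shift b N y) x
    ≡⟨ cong (N x + shift b N x +_) (shift-distrib-+ c N (shift b N) x) ⟩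
  (N x + shift b N x) + (shift c N x + shift c (shift b N) x)
    ≡⟨ cong (λ z → N x + shift b N x + (shift c N x + z)) (shift-comm c b N x) ⟩
  (N x + shift b N x) + (shift c N x + shift b (shift c N) x)
    ≡⟨ interchange (N x) (shift b N x) (shift c N x) (shift b (shift c N) x) ⟩
  (N x + shift c N x) + (shift b N x + shift b (shift c N) x)
    ≡⟨ cong (N x + shift c N x +_) (shift-distrib-+ b N (shift c N) x) ⟨
  nrep (c ∷ L) x + shift b (nrep (c ∷ L)) x ∎
  where
    open ≡-Reasoning
    N : ℕ → ℕ
    N = nrep L

nrep≤nrep-∷ʳ : ∀ L b x → nrep L x ≤ nrep (L ++ [ b ]) x
nrep≤nrep-∷ʳ L b x = subst (nrep L x ≤_) (sym (nrep-∷ʳ L b x)) (m≤m+n _ _)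

sum-∷ʳ : ∀ L b → sum (L ++ [ b ]) ≡ sum L + b
sum-∷ʳ L b = trans (sum-++ L [ b ]) (cong (sum L +_) (+-identityʳ b))

nrep-sum< : ∀ L {x} → sum L < x → nrep L x ≡ 0
nrep-sum< []      {suc x} _     = refl
nrep-sum< (a ∷ L) {x}     a+S<x = cong₂ _+_ (nrep-sum< L (≤-<-trans (m≤n+m (sum L) a) a+S<x)) shifted
  where
    shifted : shift a (nrep L) x ≡ 0
    shifted with a ≤? x
    ... | yes a≤x = trans (shift-≤ (nrep L) a≤x)
                      (nrep-sum< L (m+n≤o⇒m≤o∸n (suc (sum L))
                        (subst (_≤ x) (cong suc (+-comm a (sum L))) a+S<x)))
    ... | no a≰x  = shift-> (nrep L) (≰⇒> a≰x)

-- Taking complements of index sets.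
nrep-reflect : ∀ L {x y} → x + y ≡ sum L → nrep L x ≡ nrep L y
nrep-reflect []      {zero} {zero} _ = refl
nrep-reflect (a ∷ L) {x}    {y}    x+y≡ = begin
  nrep L x + shift a (nrep L) x
    ≡⟨ cong₂ _+_ (nrep≡shift x+y≡) (sym (nrep≡shift (trans (+-comm y x) x+y≡))) ⟩
  shift a (nrep L) y + nrep L y
    ≡⟨ +-comm _ (nrep L y) ⟩
  nrep L y + shift a (nrep L) y ∎
  where
    open ≡-Reasoning
    nrep≡shift : ∀ {x y} → x + y ≡ a + sum L → nrep L x ≡ shift a (nrep L) y
    nrep≡shift {x} {y} x+y≡ with a ≤? y
    ... | yes a≤y = trans (nrep-reflect L x+[y∸a]≡) (sym (shift-≤ (nrep L) a≤y))
      where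
        x+[y∸a]≡ : x + (y ∸ a) ≡ sum L
        x+[y∸a]≡ = trans (sym (+-∸-assoc x a≤y)) (trans (cong (_∸ a) x+y≡) (m+n∸m≡n a (sum L)))
    ... | no a≰y  = trans (nrep-sum< L S<x) (sym (shift-> (nrep L) (≰⇒> a≰y)))
      where
        S<x : sum L < x
        S<x = +-cancelʳ-< a (sum L) x
                (subst (_< x + a) (trans x+y≡ (+-comm a (sum L))) (+-monoʳ-< x (≰⇒> a≰y)))

∈ur⇒∈r : ∀ {L x} → x ∈ur L → x ∈r L
∈ur⇒∈r x∈ur = ≤-reflexive (sym x∈ur)

∈r⇒≤sum : ∀ {L x} → x ∈r L → x ≤ sum L
∈r⇒≤sum {L} x∈r = ≮⇒≥ λ S<x → contradiction (subst (1 ≤_) (nrep-sum< L S<x) x∈r) λ ()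

Complete : List ℕ → Set
Complete L = ∀ x → x ≤ sum L → x ∈r L

Complete-∷ʳ : ∀ {L b} → Complete L → b ≤ suc (sum L) → Complete (L ++ [ b ])
Complete-∷ʳ {L} {b} complete b≤1+S x x≤sum with x ≤? sum L
... | yes x≤S = ≤-trans (complete x x≤S) (nrep≤nrep-∷ʳ L b x)
... | no x≰S  = ≤-trans (complete (x ∸ b) x∸b≤S) (subst (nrep L (x ∸ b) ≤_) split (m≤n+m _ _))
  where
    b≤x : b ≤ x
    b≤x = ≤-trans b≤1+S (≰⇒> x≰S)
    x∸b≤S : x ∸ b ≤ sum L
    x∸b≤S = m≤n+o⇒m∸n≤o x b (subst (x ≤_) (trans (sum-∷ʳ L b) (+-comm (sum L) b)) x≤sum)
    split : nrep L x + nrep L (x ∸ b) ≡ nrep (L ++ [ b ]) x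
    split = sym (trans (nrep-∷ʳ L b x) (cong (nrep L x +_) (shift-≤ (nrep L) b≤x)))

∈ur-∷ʳ⁻ : ∀ {L b v} → Complete L → b ≤ v → v ∈ur (L ++ [ b ]) → sum L < v × (v ∸ b) ∈ur L
∈ur-∷ʳ⁻ {L} {b} {v} complete b≤v v∈ur = S<v , trans (cong (_+ nrep L (v ∸ b)) (sym (nrep-sum< L S<v))) split
  where
    split : nrep L v + nrep L (v ∸ b) ≡ 1
    split = trans (sym (trans (nrep-∷ʳ L b v) (cong (nrep L v +_) (shift-≤ (nrep L) b≤v)))) v∈ur
    S<v : sum L < v
    S<v = ≰⇒> λ v≤S → contradiction
      (subst (2 ≤_) split (+-mono-≤ (complete v v≤S) (complete (v ∸ b) (≤-trans (m∸n≤m v b) v≤S))))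
      λ { (s≤s ()) }

∈ur-∷ʳ⁺ : ∀ {L b x} → sum L < x + b → x ∈ur L → (x + b) ∈ur (L ++ [ b ])
∈ur-∷ʳ⁺ {L} {b} {x} S<x+b x∈ur = begin
  nrep (L ++ [ b ]) (x + b)                 ≡⟨ nrep-∷ʳ L b (x + b) ⟩
  nrep L (x + b) + shift b (nrep L) (x + b) ≡⟨ cong₂ _+_ (nrep-sum< L S<x+b) (shift-≤ (nrep L) (m≤n+m b x)) ⟩
  nrep L (x + b ∸ b)                        ≡⟨ cong (nrep L) (m+n∸n≡m x b) ⟩
  nrep L x                                  ≡⟨ x∈ur ⟩
  1                                         ∎
  where open ≡-Reasoning

All-≤-sum : ∀ L → All (_≤ sum L) L
All-≤-sum []      = []
All-≤-sum (a ∷ L) = m≤m+n a (sum L) ∷ All.map (λ b≤S → ≤-trans b≤S (m≤n+m (sum L) a)) (All-≤-sum L)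

length≤sum : ∀ {L} → All (0 <_) L → length L ≤ sum L
length≤sum []             = z≤n
length≤sum (0<a ∷ 0<all) = +-mono-≤ 0<a (length≤sum 0<all)

pred[n]<n : ∀ {n} → 0 < n → n ∸ 1 < n
pred[n]<n z<s = ≤-refl

-- positive matters only for the first term, where together with pred∈ur it forces b = 1.
record NextTerm (L : List ℕ) (b : ℕ) : Set where
  constructor nextTerm
  field
    positive : 0 < b
    above    : All (_< b) L
    pred∈ur  : (b ∸ 1) ∈ur L

open NextTerm

NextTerm⇒≤suc-sum : ∀ {L b} → NextTerm L b → b ≤ suc (sum L)
NextTerm⇒≤suc-sum {L} {b} next =
  ≤-trans (m≤n+m∸n b 1) (s≤s (∈r⇒≤sum {L} (∈ur⇒∈r {L} (pred∈ur next))))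

NextTerm[]⇒≡1 : ∀ {b} → NextTerm [] b → b ≡ 1
NextTerm[]⇒≡1 {suc zero}    _ = refl
NextTerm[]⇒≡1 {suc (suc _)} (nextTerm _ _ ())

data Meeussen : List ℕ → Set where
  []   : Meeussen []
  snoc : ∀ {L b} → Meeussen L → NextTerm L b → Meeussen (L ++ [ b ])

Meeussen-unsnoc : ∀ {L b} → Meeussen (L ++ [ b ]) → Meeussen L × NextTerm L b
Meeussen-unsnoc valid = unsnoc valid refl
  where
    unsnoc : ∀ {K L b} → Meeussen K → K ≡ L ++ [ b ] → Meeussen L × NextTerm L b
    unsnoc {L = []}    [] ()
    unsnoc {L = _ ∷ _} [] ()
    unsnoc {L = L} (snoc {L′} valid next) ≡L++b with ∷ʳ-injective L′ L ≡L++b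
    ... | refl , refl = valid , next

Meeussen⇒0∈ur : ∀ {L} → Meeussen L → 0 ∈ur L
Meeussen⇒0∈ur []                      = refl
Meeussen⇒0∈ur (snoc {L} {b} valid next) =
  trans (nrep-∷ʳ L b 0) (cong₂ _+_ (Meeussen⇒0∈ur valid) (shift-> (nrep L) (positive next)))

Meeussen⇒Complete : ∀ {L} → Meeussen L → Complete L
Meeussen⇒Complete []                .zero z≤n = ≤-refl
Meeussen⇒Complete (snoc {L} valid next) = Complete-∷ʳ {L} (Meeussen⇒Complete valid) (NextTerm⇒≤suc-sum next)

Meeussen-grow : ∀ {L} → Meeussen L → Meeussen (L ++ [ suc (sum L) ])
Meeussen-grow {L} valid = snoc valid (nextTerm z<s (All.map s≤s (All-≤-sum L)) sum∈ur)
  where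
    sum∈ur : sum L ∈ur L
    sum∈ur = trans (nrep-reflect L (+-identityʳ (sum L))) (Meeussen⇒0∈ur valid)

prefix-suc : ∀ m N → prefix m (suc N) ≡ prefix m N ++ [ m N ]
prefix-suc m N = begin
  prefix m (suc N)         ≡⟨ map-upTo m (suc N) ⟩
  applyUpTo m (suc N)      ≡⟨ applyUpTo-∷ʳ m N ⟨
  applyUpTo m N ++ [ m N ] ≡⟨ cong (_++ [ m N ]) (map-upTo m N) ⟨
  prefix m N ++ [ m N ]    ∎
  where open ≡-Reasoning

All-prefix : ∀ {P : Pred ℕ 0ℓ} m N → (∀ {i} → i < N → P (m i)) → All P (prefix m N)
All-prefix {P} m N P-below = subst (All P) (sym (map-upTo m N)) (applyUpTo⁺₁ m N P-below)

length-prefix : ∀ m N → length (prefix m N) ≡ N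
length-prefix m N = trans (length-map m (upTo N)) (length-upTo N)

applyUpTo-lookup : ∀ (L : List ℕ) m → (∀ (i : Fin (length L)) → lookup L i ≡ m (toℕ i)) →
                   applyUpTo m (length L) ≡ L
applyUpTo-lookup []      m _       = refl
applyUpTo-lookup (a ∷ L) m lookup≡ =
  cong₂ _∷_ (sym (lookup≡ Fin.zero)) (applyUpTo-lookup L (m ∘ suc) (lookup≡ ∘ Fin.suc))

nrep-prefix-mono : ∀ m N t x → nrep (prefix m N) x ≤ nrep (prefix m (t + N)) x
nrep-prefix-mono m N zero    x = ≤-refl
nrep-prefix-mono m N (suc t) x = ≤-trans (nrep-prefix-mono m N t x)
  (subst (λ L → nrep (prefix m (t + N)) x ≤ nrep L x) (sym (prefix-suc m (t + N)))
    (nrep≤nrep-∷ʳ (prefix m (t + N)) (m (t + N)) x))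

module Increasing {m : ℕ → ℕ} (incr : ∀ i → m i < m (suc i)) where

  incr-< : ∀ {i j} → i < j → m i < m j
  incr-< {i} {suc j} i<1+j with m<1+n⇒m<n∨m≡n i<1+j
  ... | inj₁ i<j  = <-trans (incr-< i<j) (incr j)
  ... | inj₂ refl = incr i

  incr-≤ : ∀ {i j} → i ≤ j → m i ≤ m j
  incr-≤ i≤j with m≤n⇒m<n∨m≡n i≤j
  ... | inj₁ i<j  = <⇒≤ (incr-< i<j)
  ... | inj₂ refl = ≤-refl

  nrep-prefix-stable : ∀ {x i} → x < m i → ∀ t → nrep (prefix m (t + i)) x ≡ nrep (prefix m i) x
  nrep-prefix-stable         x<mi zero    = refl
  nrep-prefix-stable {x} {i} x<mi (suc t) = begin
    nrep (prefix m (suc t + i)) x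
      ≡⟨ cong (λ L → nrep L x) (prefix-suc m (t + i)) ⟩
    nrep (prefix m (t + i) ++ [ m (t + i) ]) x
      ≡⟨ nrep-∷ʳ (prefix m (t + i)) (m (t + i)) x ⟩
    nrep (prefix m (t + i)) x + shift (m (t + i)) (nrep (prefix m (t + i))) x
      ≡⟨ cong (nrep (prefix m (t + i)) x +_)
           (shift-> (nrep (prefix m (t + i))) (<-≤-trans x<mi (incr-≤ (m≤n+m i t)))) ⟩
    nrep (prefix m (t + i)) x + 0
      ≡⟨ +-identityʳ _ ⟩
    nrep (prefix m (t + i)) x
      ≡⟨ nrep-prefix-stable x<mi t ⟩
    nrep (prefix m i) x ∎
    where open ≡-Reasoning

  -- Terms beyond x take no part in representing x.
  nrep-prefix-≤ : ∀ {x i} → x < m i → ∀ N → nrep (prefix m N) x ≤ nrep (prefix m i) x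
  nrep-prefix-≤ {x} {i} x<mi N = ≤-trans (nrep-prefix-mono m N i x)
    (≤-reflexive (trans (cong (λ n → nrep (prefix m n) x) (+-comm i N)) (nrep-prefix-stable x<mi N)))

InfMeeussen⇒NextTerm : ∀ {m} → InfMeeussen m → ∀ i → NextTerm (prefix m i) (m i)
InfMeeussen⇒NextTerm {m} inf i = nextTerm (positive′ i) (All-prefix m i incr-<) pred∈ur′
  where
    open InfMeeussen inf
    open Increasing incr

    positive′ : ∀ i → 0 < m i
    positive′ zero    = subst (0 <_) (sym first) z<s
    positive′ (suc i) = ≤-<-trans z≤n (incr i)

    pred∈ur′ : (m i ∸ 1) ∈ur prefix m i
    pred∈ur′ with unique i
    ... | (N , ∈ur-prefix-N) , ≤1 = ≤-antisym (≤1 i)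
      (subst (_≤ _) ∈ur-prefix-N (nrep-prefix-≤ (pred[n]<n (positive′ i)) N))

prefix-Meeussen : ∀ {m} → (∀ i → NextTerm (prefix m i) (m i)) → ∀ N → Meeussen (prefix m N)
prefix-Meeussen     next zero    = []
prefix-Meeussen {m} next (suc N) = subst Meeussen (sym (prefix-suc m N)) (snoc (prefix-Meeussen next N) (next N))

NextTerm⇒InfMeeussen : ∀ {m} → (∀ i → NextTerm (prefix m i) (m i)) → InfMeeussen m
NextTerm⇒InfMeeussen {m} next = record
  { first    = NextTerm[]⇒≡1 (next 0)
  ; incr     = incr
  ; complete = λ x → x , Meeussen⇒Complete (prefix-Meeussen next x) x (x≤sum x)
  ; unique   = λ i → (i , pred∈ur (next i)) , λ N →
      ≤-trans (nrep-prefix-≤ (pred[n]<n (positive (next i))) N) (≤-reflexive (pred∈ur (next i)))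
  }
  where
    incr : ∀ i → m i < m (suc i)
    incr i with ++⁻ʳ (prefix m i) (subst (All (_< m (suc i))) (prefix-suc m i) (above (next (suc i))))
    ... | mi<m1+i ∷ [] = mi<m1+i

    open Increasing incr

    x≤sum : ∀ x → x ≤ sum (prefix m x)
    x≤sum x = subst (_≤ sum (prefix m x)) (length-prefix m x)
                (length≤sum (All-prefix m x λ {i} _ → positive (next i)))

Meeussen-prefix⇒NextTerm : ∀ {m N i} → Meeussen (prefix m N) → i < N → NextTerm (prefix m i) (m i)
Meeussen-prefix⇒NextTerm {m} {suc N} valid i<1+N
  with Meeussen-unsnoc (subst Meeussen (prefix-suc m N) valid) | m<1+n⇒m<n∨m≡n i<1+N
... | valid′ , _    | inj₁ i<N  = Meeussen-prefix⇒NextTerm valid′ i<N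
... | _      , next | inj₂ refl = next

FinMeeussen⇒Meeussen : ∀ {L} → FinMeeussen L → Meeussen L
FinMeeussen⇒Meeussen {L} (m , inf , lookup≡) =
  subst Meeussen (trans (map-upTo m (length L)) (applyUpTo-lookup L m lookup≡))
    (prefix-Meeussen (InfMeeussen⇒NextTerm inf) (length L))

_++∞_ : List ℕ → (ℕ → ℕ) → ℕ → ℕ
([]    ++∞ f) i       = f i
((a ∷ L) ++∞ f) zero    = a
((a ∷ L) ++∞ f) (suc i) = (L ++∞ f) i

lookup-++∞ : ∀ L f (i : Fin (length L)) → lookup L i ≡ (L ++∞ f) (toℕ i)
lookup-++∞ (a ∷ L) f Fin.zero    = refl
lookup-++∞ (a ∷ L) f (Fin.suc i) = lookup-++∞ L f i

prefix-++∞ : ∀ L f t → prefix (L ++∞ f) (length L + t) ≡ L ++ prefix f t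
prefix-++∞ L f t = trans (map-upTo (L ++∞ f) (length L + t))
                     (trans (applyUpTo-++∞ L) (cong (L ++_) (sym (map-upTo f t))))
  where
    applyUpTo-++∞ : ∀ L → applyUpTo (L ++∞ f) (length L + t) ≡ L ++ applyUpTo f t
    applyUpTo-++∞ []      = refl
    applyUpTo-++∞ (a ∷ L) = cong (a ∷_) (applyUpTo-++∞ L)

++-prefix-suc : ∀ L f t → L ++ prefix f (suc t) ≡ (L ++ prefix f t) ++ [ f t ]
++-prefix-suc L f t = trans (cong (L ++_) (prefix-suc f t)) (sym (++-assoc L (prefix f t) [ f t ]))

doubling : ℕ → ℕ → ℕ
doubling s t = 2 ^ t * s

module Doubling (L : List ℕ) where

  d : ℕ → ℕ
  d = doubling (suc (sum L))

  suc-sum-doubling : ∀ t → suc (sum (L ++ prefix d t)) ≡ d t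
  suc-sum-doubling zero    = trans (cong (suc ∘ sum) (++-identityʳ L)) (sym (*-identityˡ _))
  suc-sum-doubling (suc t) = begin
    suc (sum (L ++ prefix d (suc t)))        ≡⟨ cong (suc ∘ sum) (++-prefix-suc L d t) ⟩
    suc (sum ((L ++ prefix d t) ++ [ d t ])) ≡⟨ cong suc (sum-∷ʳ (L ++ prefix d t) (d t)) ⟩
    suc (sum (L ++ prefix d t)) + d t        ≡⟨ cong (_+ d t) (suc-sum-doubling t) ⟩
    d t + d t                                ≡⟨ cong (d t +_) (+-identityʳ (d t)) ⟨
    2 * d t                                  ≡⟨ *-assoc 2 (2 ^ t) (suc (sum L)) ⟨
    d (suc t)                                ∎
    where open ≡-Reasoning

  Meeussen-doubling : Meeussen L → ∀ t → Meeussen (L ++ prefix d t)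
  Meeussen-doubling valid zero    = subst Meeussen (sym (++-identityʳ L)) valid
  Meeussen-doubling valid (suc t) =
    subst Meeussen (trans (cong (λ b → (L ++ prefix d t) ++ [ b ]) (suc-sum-doubling t)) (sym (++-prefix-suc L d t)))
      (Meeussen-grow (Meeussen-doubling valid t))

Meeussen⇒FinMeeussen : ∀ {L} → Meeussen L → FinMeeussen L
Meeussen⇒FinMeeussen {L} valid = L ++∞ d , NextTerm⇒InfMeeussen next , lookup-++∞ L d
  where
    open Doubling L

    next : ∀ i → NextTerm (prefix (L ++∞ d) i) ((L ++∞ d) i)
    next i = Meeussen-prefix⇒NextTerm
      (subst Meeussen (sym (prefix-++∞ L d (suc i))) (Meeussen-doubling valid (suc i)))
      (m≤n+m (suc i) (length L))

StrictlyIncreasing : ∀ {n} → (Fin n → ℕ) → Set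
StrictlyIncreasing f = ∀ i j → toℕ i < toℕ j → f i < f j

Enumerates : Pred ℕ 0ℓ → (n : ℕ) → (Fin n → ℕ) → Set
Enumerates P n f = StrictlyIncreasing f × (∀ v → P v ⇔ ∃ λ i → f i ≡ v)

module _ {n} {f : Fin n → ℕ} (incr : StrictlyIncreasing f) where

  StrictlyIncreasing-mono-≤ : ∀ {i j} → toℕ i ≤ toℕ j → f i ≤ f j
  StrictlyIncreasing-mono-≤ {i} {j} i≤j with m≤n⇒m<n∨m≡n i≤j
  ... | inj₁ i<j = <⇒≤ (incr i j i<j)
  ... | inj₂ i≡j = ≤-reflexive (cong f (toℕ-injective i≡j))

  StrictlyIncreasing-cancel-≤ : ∀ {i j} → f i ≤ f j → toℕ i ≤ toℕ j
  StrictlyIncreasing-cancel-≤ {i} {j} fi≤fj = ≮⇒≥ λ j<i → <⇒≱ (incr j i j<i) fi≤fj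

module _ {P : Pred ℕ 0ℓ} {n} {f : Fin n → ℕ} (enum : Enumerates P n f) where

  Enumerates-member : ∀ i → P (f i)
  Enumerates-member i = Equivalence.from (proj₂ enum (f i)) (i , refl)

  Enumerates-index : ∀ {v} → P v → ∃ λ i → f i ≡ v
  Enumerates-index {v} = Equivalence.to (proj₂ enum v)

Enumerates-resp : ∀ {P Q n f} → (∀ v → Q v ⇔ P v) → Enumerates P n f → Enumerates Q n f
Enumerates-resp Q⇔P (incr , P⇔image) = incr , λ v → P⇔image v ⇔-∘ Q⇔P v

Translate : ℕ → Pred ℕ 0ℓ → Pred ℕ 0ℓ
Translate a P v = a ≤ v × P (v ∸ a)

Reflect : ℕ → Pred ℕ 0ℓ → Pred ℕ 0ℓ
Reflect c P v = v ≤ c × P (c ∸ v)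

Enumerates-translate : ∀ {P n f} a → Enumerates P n f → Enumerates (Translate a P) n (λ i → f i + a)
Enumerates-translate {P} {n} {f} a enum@(incr , _) =
  (λ i j i<j → +-monoˡ-< a (incr i j i<j)) , λ v → mk⇔ (to v) from
  where
    to : ∀ v → Translate a P v → ∃ λ i → f i + a ≡ v
    to v (a≤v , p) with Enumerates-index enum p
    ... | i , fi≡v∸a = i , trans (cong (_+ a) fi≡v∸a) (m∸n+n≡m a≤v)
    from : ∀ {v} → (∃ λ i → f i + a ≡ v) → Translate a P v
    from (i , refl) = m≤n+m a (f i) , subst P (sym (m+n∸n≡m (f i) a)) (Enumerates-member enum i)

Enumerates-reflect : ∀ {P n f} c → Enumerates P n f → (∀ {v} → P v → v ≤ c) →
                     Enumerates (Reflect c P) n (λ i → c ∸ f (opposite i))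
Enumerates-reflect {P} {n} {f} c enum@(incr , _) ≤c = incr′ , λ v → mk⇔ (to v) from
  where
    incr′ : StrictlyIncreasing (λ i → c ∸ f (opposite i))
    incr′ i j i<j = ∸-monoʳ-< (incr (opposite j) (opposite i) opposite-reverses)
                               (≤c (Enumerates-member enum (opposite i)))
      where
        opposite-reverses : toℕ (opposite j) < toℕ (opposite i)
        opposite-reverses = subst₂ _<_ (sym (opposite-prop j)) (sym (opposite-prop i))
                              (∸-monoʳ-< (s≤s i<j) (toℕ<n j))
    to : ∀ v → Reflect c P v → ∃ λ i → c ∸ f (opposite i) ≡ v
    to v (v≤c , p) with Enumerates-index enum p
    ... | i , fi≡c∸v = opposite i ,
      trans (cong (λ k → c ∸ f k) (opposite-involutive i)) (trans (cong (c ∸_) fi≡c∸v) (m∸[m∸n]≡n v≤c))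
    from : ∀ {v} → (∃ λ i → c ∸ f (opposite i) ≡ v) → Reflect c P v
    from (i , refl) = m∸n≤m c (f (opposite i)) ,
      subst P (sym (m∸[m∸n]≡n (≤c (Enumerates-member enum (opposite i))))) (Enumerates-member enum (opposite i))

Enumerates-initialSegment : ∀ {P n f} → Enumerates P n f → (j : Fin n) →
               Enumerates (P ∩ (_≤ f j)) (suc (toℕ j)) (λ i → f (inject≤ i (toℕ<n j)))
Enumerates-initialSegment {P} {n} {f} enum@(incr , _) j = incr′ , λ v → mk⇔ (to v) from
  where
    toℕ-inject : ∀ i → toℕ (inject≤ i (toℕ<n j)) ≡ toℕ i
    toℕ-inject i = toℕ-inject≤ i (toℕ<n j)
    incr′ : StrictlyIncreasing (λ i → f (inject≤ i (toℕ<n j)))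
    incr′ i i′ i<i′ = incr _ _ (subst₂ _<_ (sym (toℕ-inject i)) (sym (toℕ-inject i′)) i<i′)
    to : ∀ v → (P ∩ (_≤ f j)) v → ∃ λ i → f (inject≤ i (toℕ<n j)) ≡ v
    to v (p , v≤fj) with Enumerates-index enum p
    ... | i , refl =
      fromℕ< (s≤s i≤j) , cong f (toℕ-injective (trans (toℕ-inject _) (toℕ-fromℕ< (s≤s i≤j))))
      where
        i≤j : toℕ i ≤ toℕ j
        i≤j = StrictlyIncreasing-cancel-≤ incr v≤fj
    from : ∀ {v} → (∃ λ i → f (inject≤ i (toℕ<n j)) ≡ v) → (P ∩ (_≤ f j)) v
    from (i , refl) = Enumerates-member enum _ ,
      StrictlyIncreasing-mono-≤ incr (subst (_≤ toℕ j) (sym (toℕ-inject i)) (s≤s⁻¹ (toℕ<n i)))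

Enumerates-∪ : ∀ {P Q m n f g} → Enumerates P m f → Enumerates Q n g → (∀ {v w} → P v → Q w → v < w) →
               Enumerates (P ∪ Q) (m + n) (f Vector.++ g)
Enumerates-∪ {P} {Q} {m} {n} {f} {g} enumP@(incrP , _) enumQ@(incrQ , _) P<Q = incr , λ v → mk⇔ (to v) (from v)
  where
    incr-split : ∀ s s′ → toℕ (join m n s) < toℕ (join m n s′) → [ f , g ]′ s < [ f , g ]′ s′
    incr-split (inj₁ i) (inj₁ i′) lt = incrP i i′ (subst₂ _<_ (toℕ-↑ˡ i n) (toℕ-↑ˡ i′ n) lt)
    incr-split (inj₁ i) (inj₂ i′) _  = P<Q (Enumerates-member enumP i) (Enumerates-member enumQ i′)
    incr-split (inj₂ i) (inj₁ i′) lt =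
      contradiction (<-trans (subst₂ _<_ (toℕ-↑ʳ m i) (toℕ-↑ˡ i′ n) lt) (toℕ<n i′)) (m+n≮m m (toℕ i))
    incr-split (inj₂ i) (inj₂ i′) lt =
      incrQ i i′ (+-cancelˡ-< m _ _ (subst₂ _<_ (toℕ-↑ʳ m i) (toℕ-↑ʳ m i′) lt))
    incr : StrictlyIncreasing (f Vector.++ g)
    incr t t′ t<t′ = incr-split (splitAt m t) (splitAt m t′)
      (subst₂ _<_ (cong toℕ (sym (join-splitAt m n t))) (cong toℕ (sym (join-splitAt m n t′))) t<t′)
    to : ∀ v → (P ∪ Q) v → ∃ λ t → (f Vector.++ g) t ≡ v
    to v (inj₁ p) with Enumerates-index enumP p
    ... | i , fi≡v = i ↑ˡ n , trans (lookup-++ˡ f g i) fi≡v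
    to v (inj₂ q) with Enumerates-index enumQ q
    ... | i , gi≡v = m ↑ʳ i , trans (lookup-++ʳ f g i) gi≡v
    from-split : ∀ v s → [ f , g ]′ s ≡ v → (P ∪ Q) v
    from-split v (inj₁ i) refl = inj₁ (Enumerates-member enumP i)
    from-split v (inj₂ i) refl = inj₂ (Enumerates-member enumQ i)
    from : ∀ v → (∃ λ t → (f Vector.++ g) t ≡ v) → (P ∪ Q) v
    from v (t , eq) = from-split v (splitAt m t) eq

extend-by-candidate : ∀ {ms mn c} → Meeussen (ms ++ [ mn ]) → IsCandidate ms mn c →
                      Meeussen ((ms ++ [ mn ]) ++ [ suc c ])
extend-by-candidate {ms} {c = c} valid (c∈ur , mn≤c) =
  snoc valid (nextTerm z<s (++⁺ ms<1+c (s≤s mn≤c ∷ [])) c∈ur)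
  where
    ms<1+c : All (_< suc c) ms
    ms<1+c = All.map (λ x<mn → <-trans x<mn (s≤s mn≤c)) (above (proj₂ (Meeussen-unsnoc valid)))

module Candidates {ms : List ℕ} {mn : ℕ} (valid : Meeussen (ms ++ [ mn ])) where

  private
    M : List ℕ
    M = ms ++ [ mn ]

    S : ℕ
    S = sum M

    S≡ : S ≡ sum ms + mn
    S≡ = sum-∷ʳ ms mn

    complete-ms : Complete ms
    complete-ms = Meeussen⇒Complete (proj₁ (Meeussen-unsnoc valid))

    complete-M : Complete M
    complete-M = Meeussen⇒Complete valid

    mn≤1+sum : mn ≤ suc (sum ms)
    mn≤1+sum = NextTerm⇒≤suc-sum (proj₂ (Meeussen-unsnoc valid))

  candidate>sum : ∀ {v} → IsCandidate ms mn v → sum ms < v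
  candidate>sum (v∈ur , mn≤v) = proj₁ (∈ur-∷ʳ⁻ {ms} complete-ms mn≤v v∈ur)

  candidate≤sum : ∀ {v} → IsCandidate ms mn v → v ≤ S
  candidate≤sum (v∈ur , _) = ∈r⇒≤sum {M} (∈ur⇒∈r {M} v∈ur)

  Upper Lower : ℕ → Pred ℕ 0ℓ
  Upper c = Translate (suc c) (IsCandidate ms mn)
  Lower c = Translate (suc c) (Reflect S (IsCandidate ms mn ∩ (_≤ c)))

  Lower<Upper : ∀ {c v w} → Lower c v → Upper c w → v < w
  Lower<Upper {c} {v} {w} (a≤v , x≤S , (S∸x-cand , _)) (a≤w , y-cand) =
    subst₂ _<_ (m∸n+n≡m a≤v) (m∸n+n≡m a≤w) (+-monoˡ-< (suc c) x<y)
    where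
      x y : ℕ
      x = v ∸ suc c
      y = w ∸ suc c
      x<y : x < y
      x<y = ≰⇒> λ y≤x → <⇒≱
        (subst (_< (S ∸ x) + y) (sym S≡) (+-mono-<-≤ (candidate>sum S∸x-cand) (proj₂ y-cand)))
        (subst ((S ∸ x) + y ≤_) (m∸n+n≡m x≤S) (+-monoʳ-≤ (S ∸ x) y≤x))

  candidates-∷ʳ : ∀ {c} → mn ≤ c → ∀ v → IsCandidate M (suc c) v ⇔ (Lower c ∪ Upper c) v
  candidates-∷ʳ {c} mn≤c v = mk⇔ to from
    where
      a : ℕ
      a = suc c

      candidate : a ≤ v → (v ∸ a) ∈ur M → S < (v ∸ a) + a → IsCandidate M a v
      candidate a≤v x∈ur S<x+a =
        subst (IsCandidate M a) (m∸n+n≡m a≤v) (∈ur-∷ʳ⁺ {M} S<x+a x∈ur , m≤n+m a _)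

      to : IsCandidate M a v → (Lower c ∪ Upper c) v
      to (v∈ur , a≤v) with ∈ur-∷ʳ⁻ {M} complete-M a≤v v∈ur | mn ≤? v ∸ a
      ... | _   , x∈ur | yes mn≤x = inj₂ (a≤v , x∈ur , mn≤x)
      ... | S<v , x∈ur | no mn≰x  = inj₁ (a≤v , x≤S , (S∸x∈ur , mn≤S∸x) , S∸x≤c)
        where
          x : ℕ
          x = v ∸ a
          x≤S : x ≤ S
          x≤S = ∈r⇒≤sum {M} (∈ur⇒∈r {M} x∈ur)
          S∸x∈ur : (S ∸ x) ∈ur M
          S∸x∈ur = trans (sym (nrep-reflect M (m+[n∸m]≡n x≤S))) x∈ur
          mn≤S∸x : mn ≤ S ∸ x
          mn≤S∸x = ≤-trans mn≤1+sum (m+n≤o⇒m≤o∸n (suc (sum ms))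
                     (subst (suc (sum ms + x) ≤_) (sym S≡) (+-monoʳ-< (sum ms) (≰⇒> mn≰x))))
          S∸x≤c : S ∸ x ≤ c
          S∸x≤c = s≤s⁻¹ (m<n+o⇒m∸n<o S x (subst (S <_) (sym (m∸n+n≡m a≤v)) S<v))

      from : (Lower c ∪ Upper c) v → IsCandidate M a v
      from (inj₁ (a≤v , x≤S , (S∸x∈ur , _) , S∸x≤c)) =
        candidate a≤v (trans (nrep-reflect M (m+[n∸m]≡n x≤S)) S∸x∈ur)
          (subst₂ _<_ (m∸n+n≡m x≤S) (+-comm a (v ∸ a)) (+-monoˡ-< (v ∸ a) (s≤s S∸x≤c)))
      from (inj₂ (a≤v , x∈ur , mn≤x)) =
        candidate a≤v x∈ur
          (subst (_< v ∸ a + a) (sym S≡) (+-mono-< (candidate>sum (x∈ur , mn≤x)) (s≤s mn≤c)))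

  candidates-after : ∀ {k u} → Enumerates (IsCandidate ms mn) k u → (j : Fin k) →
                     HasExactlyCandidates M (suc (u j)) (k + suc (toℕ j))
  candidates-after {k} {u} cands j =
    subst (HasExactlyCandidates M a) (+-comm (suc (toℕ j)) k)
      (_ , Enumerates-resp (candidates-∷ʳ (proj₂ (Enumerates-member cands j)))
             (Enumerates-∪ lower upper Lower<Upper))
    where
      a : ℕ
      a = suc (u j)
      lower : Enumerates (Lower (u j)) (suc (toℕ j)) (λ t → S ∸ u (inject≤ (opposite t) (toℕ<n j)) + a)
      lower = Enumerates-translate a
                (Enumerates-reflect S (Enumerates-initialSegment cands j) (candidate≤sum ∘ proj₁))
      upper : Enumerates (Upper (u j)) k (λ i → u i + a)
      upper = Enumerates-translate a cands

proposition1 : (ms : List ℕ) (mn : ℕ) → FinMeeussen (ms ++ [ mn ]) →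
    (k : ℕ) (u : Fin k → ℕ) → CandidatesEnum ms mn k u →
    (j : Fin k) →
      FinMeeussen ((ms ++ [ mn ]) ++ [ suc (u j) ]) ×
      HasExactlyCandidates (ms ++ [ mn ]) (suc (u j)) (k + suc (toℕ j))
proposition1 ms mn fin k u cands j =
  Meeussen⇒FinMeeussen (extend-by-candidate valid (Enumerates-member cands j)) ,
  Candidates.candidates-after valid cands j
  where
    valid : Meeussen (ms ++ [ mn ])
    valid = FinMeeussen⇒Meeussen fin
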